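{- Let $X_1,X_2,X_3$ be pairwise disjoint vertex subsets of $G_3$ with $V(G_3)=X_1\cup X_2\cup X_3$ and $|X_1|\ge|X_2|\ge|X_3|>0$. Then $\sum_{1\le i<j\le 3}e(X_i,X_j)\ge 5$, and if equality holds then $(|X_1|,|X_2|,|X_3|)=(6,1,1)$ and $e(X_i,X_j)>0$ for all $1\le i<j\le 3$.
   Context: $G_3$ is the 3-dimensional locally twisted cube: vertex set $\{0,1\}^3$ and the 12 edges $000\text{ - }001$, $001\text{ - }011$, $011\text{ - }010$, $010\text{ - }000$, $100\text{ - }101$, $101\text{ - }111$, $111\text{ - }110$, $110\text{ - }100$, $000\text{ - }100$, $010\text{ - }110$, $001\text{ - }111$, $011\text{ - }101$. For vertex sets $X,Y$, $e(X,Y)$ is the number of edges with one end in $X$ and the other end in $Y$. -}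

module Defs where

open import Data.Bool using (Bool; true; false; _∧_; _∨_; if_then_else_)
open import Data.Nat using (ℕ; zero; suc; _+_)
open import Data.Fin using (Fin; #_)
open import Data.Fin.Subset using (Subset)
open import Data.Vec using (lookup)
open import Data.List using (List; []; _∷_; foldr)
open import Data.Product using (_×_; _,_)

-- Vertices of G_3: Fin 8, where the binary string b₂b₁b₀ is the number 4b₂+2b₁+b₀.
V : Set
V = Fin 8

-- The 12 edges of the 3-dimensional locally twisted cube G_3.
edgesG3 : List (V × V)
edgesG3 =
  (# 0 , # 1) ∷ (# 1 , # 3) ∷ (# 3 , # 2) ∷ (# 2 , # 0) ∷
  (# 4 , # 5) ∷ (# 5 , # 7) ∷ (# 7 , # 6) ∷ (# 6 , # 4) ∷
  (# 0 , # 4) ∷ (# 2 , # 6) ∷ (# 1 , # 7) ∷ (# 3 , # 5) ∷ [] -- 000-100, 010-110, 001-111, 011-101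

e : Subset 8 → Subset 8 → ℕ
e X Y = foldr step 0 edgesG3
  where
  step : V × V → ℕ → ℕ
  step (u , v) n =
    if (lookup X u ∧ lookup Y v) ∨ (lookup Y u ∧ lookup X v) then suc n else n

module Submission where

open import Defs
open import Data.Bool using (Bool; true; false; T; _∧_; _∨_)
open import Data.Bool.Properties using (T-∧)
open import Data.Unit using (tt)
open import Data.Nat using (ℕ; _+_; _≤_; _<_)
import Data.Nat as ℕ
open import Data.Nat.Properties using (_≤?_; _<?_; _≟_)
open import Data.Fin using (Fin; zero; suc)
import Data.Fin.Properties as Fin
open import Data.Fin.Subset using (Subset; _∩_; _∪_; ⊥; ⊤; ∣_∣)
open import Data.Vec using (Vec; []; _∷_; map)
open import Data.Vec.Properties using (∷-injective)
open import Data.Product using (_×_; Σ-syntax; _,_; proj₁; proj₂)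
open import Function.Bundles using (Equivalence)
open import Relation.Binary.PropositionalEquality using (_≡_; refl; cong₂)
open import Relation.Nullary.Decidable using (Dec; _×-dec_; _→-dec_; ⌊_⌋; toWitness)

Colouring : ℕ → ℕ → Set
Colouring k n = Vec (Fin k) n

colourClass : ∀ {k n} → Fin k → Colouring k n → Subset n
colourClass i = map (λ c → ⌊ c Fin.≟ i ⌋)

class₁ class₂ class₃ : ∀ {n} → Colouring 3 n → Subset n
class₁ = colourClass zero
class₂ = colourClass (suc zero)
class₃ = colourClass (suc (suc zero))

colourOf : ∀ a b c → a ∧ b ≡ false → a ∧ c ≡ false → b ∧ c ≡ false → a ∨ b ∨ c ≡ true →
  Σ[ i ∈ Fin 3 ] (a ≡ ⌊ i Fin.≟ zero ⌋ × b ≡ ⌊ i Fin.≟ suc zero ⌋ × c ≡ ⌊ i Fin.≟ suc (suc zero) ⌋)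
colourOf true  false false refl refl refl refl = zero , refl , refl , refl
colourOf false true  false refl refl refl refl = suc zero , refl , refl , refl
colourOf false false true  refl refl refl refl = suc (suc zero) , refl , refl , refl

partition⇒colouring : ∀ {n} (X₁ X₂ X₃ : Subset n) →
  X₁ ∩ X₂ ≡ ⊥ → X₁ ∩ X₃ ≡ ⊥ → X₂ ∩ X₃ ≡ ⊥ → X₁ ∪ X₂ ∪ X₃ ≡ ⊤ →
  Σ[ c ∈ Colouring 3 n ] (X₁ ≡ class₁ c × X₂ ≡ class₂ c × X₃ ≡ class₃ c)
partition⇒colouring [] [] [] _ _ _ _ = [] , refl , refl , refl
partition⇒colouring (a ∷ X₁) (b ∷ X₂) (c ∷ X₃) d₁₂ d₁₃ d₂₃ cover
  with ∷-injective d₁₂ | ∷-injective d₁₃ | ∷-injective d₂₃ | ∷-injective cover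
... | ab , X₁₂ | ac , X₁₃ | bc , X₂₃ | abc , X₁₂₃
  with colourOf a b c ab ac bc abc | partition⇒colouring X₁ X₂ X₃ X₁₂ X₁₃ X₂₃ X₁₂₃
... | i , a≡ , b≡ , c≡ | col , X₁≡ , X₂≡ , X₃≡ =
  i ∷ col , cong₂ _∷_ a≡ X₁≡ , cong₂ _∷_ b≡ X₂≡ , cong₂ _∷_ c≡ X₃≡

allFin? : ∀ k → (Fin k → Bool) → Bool
allFin? ℕ.zero    p = true
allFin? (ℕ.suc k) p = p zero ∧ allFin? k (λ i → p (suc i))

allFin?-sound : ∀ k (p : Fin k → Bool) → T (allFin? k p) → ∀ i → T (p i)
allFin?-sound (ℕ.suc k) p holds zero    = proj₁ (Equivalence.to T-∧ holds)
allFin?-sound (ℕ.suc k) p holds (suc i) =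
  allFin?-sound k (λ j → p (suc j)) (proj₂ (Equivalence.to (T-∧ {p zero}) holds)) i

allColourings? : ∀ {k} n → (Colouring k n → Bool) → Bool
allColourings? ℕ.zero        p = p []
allColourings? {k} (ℕ.suc n) p = allFin? k λ i → allColourings? n λ c → p (i ∷ c)

AllColouringsPass : ∀ {k} n {P : Colouring k n → Set} → (∀ c → Dec (P c)) → Set
AllColouringsPass n P? = T (allColourings? n λ c → ⌊ P? c ⌋)

allColourings?-sound : ∀ {k} n {P : Colouring k n → Set} (P? : ∀ c → Dec (P c)) →
  AllColouringsPass n P? → ∀ c → P c
allColourings?-sound ℕ.zero        P? holds []      = toWitness holds
allColourings?-sound {k} (ℕ.suc n) P? holds (i ∷ c) =
  allColourings?-sound n (λ c′ → P? (i ∷ c′))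
    (allFin?-sound k (λ j → allColourings? n λ c′ → ⌊ P? (j ∷ c′) ⌋) holds i) c

Bound : Subset 8 → Subset 8 → Subset 8 → Set
Bound X₁ X₂ X₃ =
  ∣ X₂ ∣ ≤ ∣ X₁ ∣ → ∣ X₃ ∣ ≤ ∣ X₂ ∣ → 0 < ∣ X₃ ∣ →
  (5 ≤ e X₁ X₂ + e X₁ X₃ + e X₂ X₃)
  × (e X₁ X₂ + e X₁ X₃ + e X₂ X₃ ≡ 5 →
      (∣ X₁ ∣ ≡ 6 × ∣ X₂ ∣ ≡ 1 × ∣ X₃ ∣ ≡ 1)
      × (0 < e X₁ X₂ × 0 < e X₁ X₃ × 0 < e X₂ X₃))

bound? : ∀ X₁ X₂ X₃ → Dec (Bound X₁ X₂ X₃)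
bound? X₁ X₂ X₃ =
  (∣ X₂ ∣ ≤? ∣ X₁ ∣) →-dec (∣ X₃ ∣ ≤? ∣ X₂ ∣) →-dec (0 <? ∣ X₃ ∣) →-dec
  ((5 ≤? e X₁ X₂ + e X₁ X₃ + e X₂ X₃)
   ×-dec ((e X₁ X₂ + e X₁ X₃ + e X₂ X₃ ≟ 5) →-dec
           (((∣ X₁ ∣ ≟ 6) ×-dec (∣ X₂ ∣ ≟ 1) ×-dec (∣ X₃ ∣ ≟ 1))
            ×-dec ((0 <? e X₁ X₂) ×-dec (0 <? e X₁ X₃) ×-dec (0 <? e X₂ X₃)))))

colouringBound? : ∀ c → Dec (Bound (class₁ c) (class₂ c) (class₃ c))
colouringBound? c = bound? (class₁ c) (class₂ c) (class₃ c)

-- Step 3b: the exhaustive check; `tt` is accepted because the search over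
-- all 3⁸ colourings evaluates to true.
colouringBound : ∀ c → Bound (class₁ c) (class₂ c) (class₃ c)
colouringBound = allColourings?-sound 8 colouringBound? tt

-- It is stated for
-- abstract parts so that the edge counts e are never unfolded on sets given by
-- a symbolic colouring, which would make type checking blow up.
Bound-cong : ∀ {X₁ X₂ X₃ Y₁ Y₂ Y₃} → X₁ ≡ Y₁ → X₂ ≡ Y₂ → X₃ ≡ Y₃ →
  Bound Y₁ Y₂ Y₃ → Bound X₁ X₂ X₃
Bound-cong refl refl refl bound = bound

lemma2p5 : (X₁ X₂ X₃ : Subset 8) →
    X₁ ∩ X₂ ≡ ⊥ → X₁ ∩ X₃ ≡ ⊥ → X₂ ∩ X₃ ≡ ⊥ →
    X₁ ∪ X₂ ∪ X₃ ≡ ⊤ →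
    ∣ X₂ ∣ ≤ ∣ X₁ ∣ → ∣ X₃ ∣ ≤ ∣ X₂ ∣ → 0 < ∣ X₃ ∣ →
    (5 ≤ e X₁ X₂ + e X₁ X₃ + e X₂ X₃)
    × (e X₁ X₂ + e X₁ X₃ + e X₂ X₃ ≡ 5 →
        (∣ X₁ ∣ ≡ 6 × ∣ X₂ ∣ ≡ 1 × ∣ X₃ ∣ ≡ 1)
        × (0 < e X₁ X₂ × 0 < e X₁ X₃ × 0 < e X₂ X₃))
lemma2p5 X₁ X₂ X₃ d₁₂ d₁₃ d₂₃ cover =
  let c , X₁≡ , X₂≡ , X₃≡ = partition⇒colouring X₁ X₂ X₃ d₁₂ d₁₃ d₂₃ cover
  in  Bound-cong X₁≡ X₂≡ X₃≡ (colouringBound c)
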